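{- Every strongly regular graph with parameters $(3250,57,0,1)$ contains at most $266\,266\,000$ induced subgraphs isomorphic to the Petersen graph.
   Context: A strongly regular graph $srg(n,k,\lambda,\mu)$ is a $k$-regular graph on $n$ vertices in which any two adjacent vertices have exactly $\lambda$ common neighbours and any two distinct non-adjacent vertices have exactly $\mu$ common neighbours. The Petersen graph is the unique $srg(10,3,0,1)$. -}

module Defs where

open import Data.Nat using (ℕ)
open import Data.Bool using (Bool; true; false; _∧_; not)
open import Data.Fin using (Fin; zero; suc; _≟_)
open import Data.Fin.Subset using (Subset; _∈_)
open import Data.List using (List; length; filterᵇ; allFin)
open import Data.Product using (_×_; _,_; Σ; ∃)
open import Data.Vec using (Vec; []; _∷_; lookup)
open import Relation.Nullary.Decidable using (⌊_⌋)
open import Relation.Binary.PropositionalEquality using (_≡_)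
open import Function.Bundles using (_⇔_)
open import Function.Definitions using (Injective)

record Graph (n : ℕ) : Set where
  field
    adj   : Fin n → Fin n → Bool
    sym   : ∀ i j → adj i j ≡ adj j i
    irrefl : ∀ i → adj i i ≡ false
open Graph public

countᵇ : {n : ℕ} → (Fin n → Bool) → ℕ
countᵇ {n} p = length (filterᵇ p (allFin n))

degree : {n : ℕ} → Graph n → Fin n → ℕ
degree G i = countᵇ (λ k → adj G i k)

commonNeighbours : {n : ℕ} → Graph n → Fin n → Fin n → ℕ
commonNeighbours G i j = countᵇ (λ k → adj G i k ∧ adj G j k)

IsSRG : (n k l m : ℕ) → Graph n → Set
IsSRG n k l m G =
  (∀ i → degree G i ≡ k) ×
  (∀ i j → adj G i j ≡ true → commonNeighbours G i j ≡ l) ×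
  (∀ i j → ¬≡ i j → adj G i j ≡ false → commonNeighbours G i j ≡ m)
  where
  open import Relation.Nullary using (¬_)
  ¬≡ : Fin n → Fin n → Set
  ¬≡ i j = ¬ (i ≡ j)

-- The Petersen graph, realised as the Kneser graph K(5,2):
-- vertices are the 2-subsets of {0,…,4}, adjacent iff disjoint.
petersenPairs : Vec (Fin 5 × Fin 5) 10
petersenPairs =
  (f0 , f1) ∷ (f0 , f2) ∷ (f0 , f3) ∷ (f0 , f4) ∷ (f1 , f2) ∷
  (f1 , f3) ∷ (f1 , f4) ∷ (f2 , f3) ∷ (f2 , f4) ∷ (f3 , f4) ∷ []
  where
  f0 f1 f2 f3 f4 : Fin 5
  f0 = zero
  f1 = suc zero
  f2 = suc (suc zero)
  f3 = suc (suc (suc zero))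
  f4 = suc (suc (suc (suc zero)))

_≠ᵇ_ : Fin 5 → Fin 5 → Bool
a ≠ᵇ b = not ⌊ a ≟ b ⌋

disjointᵇ : Fin 5 × Fin 5 → Fin 5 × Fin 5 → Bool
disjointᵇ (a , b) (c , d) = (a ≠ᵇ c) ∧ (a ≠ᵇ d) ∧ (b ≠ᵇ c) ∧ (b ≠ᵇ d)

petersenAdj : Fin 10 → Fin 10 → Bool
petersenAdj i j = disjointᵇ (lookup petersenPairs i) (lookup petersenPairs j)

InducesPetersen : {n : ℕ} → Graph n → Subset n → Set
InducesPetersen {n} G S =
  Σ (Fin 10 → Fin n) λ f →
    Injective _≡_ _≡_ f ×
    (∀ v → (v ∈ S) ⇔ ∃ (λ i → f i ≡ v)) ×
    (∀ i j → adj G (f i) (f j) ≡ petersenAdj i j)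

-- Fix a frame of the Petersen graph: a vertex u, its three neighbours a, b, c in
-- order, and a further neighbour a₁ of a.  Every other vertex is reached from the
-- frame by repeatedly taking a common neighbour of two non-adjacent vertices
-- already reached, and when μ = 1 such a common neighbour is unique; hence an
-- induced copy of the Petersen graph, together with an embedding onto it, is
-- determined by the image of the frame.  Twisting the embedding by the 120
-- automorphisms of the Petersen graph gives 120 embeddings of each copy with
-- distinct frame images, whereas a 57-regular graph on n vertices contains at
-- most n · 57 · 56 · 55 · 56 frames.  So 120 · #copies ≤ 3250 · 57 · 56 · 55 · 56.
module Submission where

open import Defs hiding (sym)
open import Data.List.Relation.Unary.All using (All)
open import Data.List.Relation.Unary.Unique.Propositional using (Unique)
open import Data.Nat using (_≤_; _+_; _*_; z≤n; s≤s)
open import Data.Nat.Properties using (m≤n⇒m≤1+n; <⇒≱; ≤-reflexive; *-cancelʳ-≤)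
open import Data.Bool using (Bool; true; false; T; _∧_; _∨_)
import Data.Bool.Properties as Bool
open import Data.Fin using (Fin; zero; suc; _≟_; toℕ; cast; combine; remQuot; punchOut)
open import Data.Fin.Patterns
open import Data.Fin.Properties using (all?; any?; toℕ-injective; toℕ-cast; injective⇒≤)
open import Data.Fin.Properties using (combine-injective; combine-remQuot; punchOut-injective)
open import Data.Fin.Subset using (Subset; _⊆_) renaming (_∈_ to _∈ₛ_)
open import Data.Fin.Subset.Properties using (⊆-antisym)
open import Data.List using (List; []; _∷_; [_]; length; concatMap; map; allFin; filterᵇ; findIndexᵇ; lookup)
import Data.List.Relation.Unary.All as All
open import Data.List.Relation.Unary.AllPairs using (_∷_)
open import Data.List.Relation.Unary.Any using (here; there; index)
open import Data.List.Relation.Unary.Any.Properties using (lookup-index)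
open import Data.List.Membership.Propositional using (_∈_)
open import Data.List.Membership.Propositional.Properties using (∈-lookup; ∈-allFin; ∈-filter⁺)
open import Data.List.Relation.Unary.Unique.DecPropositional using (unique?)
open import Data.Maybe using (fromMaybe)
open import Data.Product using (∃; _×_; _,_; proj₁; proj₂; uncurry)
open import Data.Product.Properties using (×-≡,≡→≡)
open import Data.Vec using (Vec; []; _∷_; insertAt; toList; tabulate)
import Data.Vec as Vec
import Data.Vec.Properties as Vec
open import Data.Vec.Relation.Binary.Pointwise.Extensional using (ext; Pointwise-≡⇒≡)
open import Data.Empty using (⊥-elim-irr)
open import Function using (_∘_)
open import Function.Bundles using (_⇔_; Equivalence)
open import Function.Definitions using (Injective; StrictlySurjective)
open import Relation.Nullary using (Dec; contradiction)
open import Relation.Nullary.Decidable using (toWitness; map′; decidable-stable; recompute; T?; ⌊_⌋)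
open import Relation.Nullary.Decidable using (_×-dec_; _→-dec_)
open import Relation.Binary.PropositionalEquality
  using (_≡_; _≢_; refl; sym; trans; cong; cong₂; subst; ≢-sym; _≗_; module ≡-Reasoning)

∈⇒1≤length : ∀ {A : Set} {x : A} {xs} → x ∈ xs → 1 ≤ length xs
∈⇒1≤length (here _)  = s≤s z≤n
∈⇒1≤length (there _) = s≤s z≤n

distinct-∈⇒2≤length : ∀ {A : Set} {x y : A} {xs} → x ≢ y → x ∈ xs → y ∈ xs → 2 ≤ length xs
distinct-∈⇒2≤length x≢y (here refl) (here refl) = contradiction refl x≢y
distinct-∈⇒2≤length _   (here _)    (there y∈)  = s≤s (∈⇒1≤length y∈)
distinct-∈⇒2≤length _   (there x∈)  (here _)    = s≤s (∈⇒1≤length x∈)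
distinct-∈⇒2≤length x≢y (there x∈)  (there y∈)  = m≤n⇒m≤1+n (distinct-∈⇒2≤length x≢y x∈ y∈)

Unique⇒lookup-injective : ∀ {A : Set} {xs : List A} → Unique xs → Injective _≡_ _≡_ (lookup xs)
Unique⇒lookup-injective (_ ∷ _)    {zero}  {zero}  _ = refl
Unique⇒lookup-injective (x∉ ∷ _)   {zero}  {suc j} e = contradiction e (All.lookup x∉ (∈-lookup j))
Unique⇒lookup-injective (x∉ ∷ _)   {suc i} {zero}  e = contradiction (sym e) (All.lookup x∉ (∈-lookup i))
Unique⇒lookup-injective (_ ∷ uniq) {suc i} {suc j} e = cong suc (Unique⇒lookup-injective uniq e)

injective₂⇒*≤ : ∀ {m k N} (F : Fin m → Fin k → Fin N) →
  (∀ {i j i′ j′} → F i j ≡ F i′ j′ → i ≡ i′ × j ≡ j′) → m * k ≤ N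
injective₂⇒*≤ {m} {k} F F-injective = injective⇒≤ {f = uncurry F ∘ remQuot {m} k} λ {x} {y} e → begin
    x                                   ≡⟨ sym (combine-remQuot {m} k x) ⟩
    uncurry combine (remQuot {m} k x)   ≡⟨ cong (uncurry combine) (×-≡,≡→≡ (F-injective e)) ⟩
    uncurry combine (remQuot {m} k y)   ≡⟨ combine-remQuot {m} k y ⟩
    y                                   ∎
  where open ≡-Reasoning

injective? : ∀ {m n} (f : Fin m → Fin n) → Dec (Injective _≡_ _≡_ f)
injective? f = map′ (λ inj → inj _ _) (λ inj _ _ → inj)
  (all? λ i → all? λ j → (f i ≟ f j) →-dec (i ≟ j))

cast-injective : ∀ {m n} .(eq : m ≡ n) → Injective _≡_ _≡_ (cast eq)
cast-injective eq {x} {y} e = toℕ-injective (begin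
  toℕ x           ≡⟨ sym (toℕ-cast eq x) ⟩
  toℕ (cast eq x) ≡⟨ cong toℕ e ⟩
  toℕ (cast eq y) ≡⟨ toℕ-cast eq y ⟩
  toℕ y           ∎)
  where open ≡-Reasoning

strictlySurjective? : ∀ {m n} (f : Fin m → Fin n) → Dec (StrictlySurjective _≡_ f)
strictlySurjective? f = all? λ y → any? λ x → f x ≟ y

IsEmbedding : ∀ {h n} → (Fin h → Fin h → Bool) → (Fin n → Fin n → Bool) → (Fin h → Fin n) → Set
IsEmbedding adjH adjG f = Injective _≡_ _≡_ f × (∀ i j → adjG (f i) (f j) ≡ adjH i j)

isEmbedding? : ∀ {h n} adjH adjG (f : Fin h → Fin n) → Dec (IsEmbedding adjH adjG f)
isEmbedding? adjH adjG f = injective? f ×-dec (all? λ i → all? λ j → adjG (f i) (f j) Bool.≟ adjH i j)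

isEmbedding-∘ : ∀ {h k n} {adjH adjK adjG} {f : Fin k → Fin n} {g : Fin h → Fin k} →
  IsEmbedding adjK adjG f → IsEmbedding adjH adjK g → IsEmbedding adjH adjG (f ∘ g)
isEmbedding-∘ {g = g} (f-inj , f-adj) (g-inj , g-adj) =
  g-inj ∘ f-inj , λ i j → trans (f-adj (g i) (g j)) (g-adj i j)

InducesPetersen⇒isEmbedding : ∀ {n} {G : Graph n} {S} ((f , _) : InducesPetersen G S) →
  IsEmbedding petersenAdj (adj G) f
InducesPetersen⇒isEmbedding (_ , f-inj , _ , f-adj) = f-inj , f-adj

IsImageOf : ∀ {m n} → Subset n → (Fin m → Fin n) → Set
IsImageOf S f = ∀ v → v ∈ₛ S ⇔ ∃ λ k → f k ≡ v

image-⊆ : ∀ {h m n} {S S′ : Subset n} {f g : Fin m → Fin n} {σ τ : Fin h → Fin m} →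
  IsImageOf S f → IsImageOf S′ g → StrictlySurjective _≡_ σ → f ∘ σ ≗ g ∘ τ → S ⊆ S′
image-⊆ {f = f} {g} {σ} {τ} S≈f S′≈g σ-surjective f∘σ≗g∘τ {v} v∈S =
  let k , fk≡v   = Equivalence.to (S≈f v) v∈S
      k₀ , σk₀≡k = σ-surjective k
  in Equivalence.from (S′≈g v) (τ k₀ , (begin
    g (τ k₀) ≡⟨ sym (f∘σ≗g∘τ k₀) ⟩
    f (σ k₀) ≡⟨ cong f σk₀≡k ⟩
    f k      ≡⟨ fk≡v ⟩
    v        ∎))
  where open ≡-Reasoning

module CommonNeighbours {n} (G : Graph n)
  (μ≤1 : ∀ X Y → X ≢ Y → adj G X Y ≡ false → commonNeighbours G X Y ≤ 1) where

  common-neighbour-unique : ∀ {X Y V W} → X ≢ Y → adj G X Y ≡ false →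
    adj G X V ≡ true → adj G Y V ≡ true → adj G X W ≡ true → adj G Y W ≡ true → V ≡ W
  common-neighbour-unique {X} {Y} {V} {W} X≢Y X≁Y X∼V Y∼V X∼W Y∼W =
    decidable-stable (V ≟ W) λ V≢W →
      <⇒≱ (distinct-∈⇒2≤length V≢W (common V X∼V Y∼V) (common W X∼W Y∼W)) (μ≤1 X Y X≢Y X≁Y)
    where
    common : ∀ Z → adj G X Z ≡ true → adj G Y Z ≡ true →
      Z ∈ filterᵇ (λ k → adj G X k ∧ adj G Y k) (allFin n)
    common Z X∼Z Y∼Z = ∈-filter⁺ (λ k → T? (adj G X k ∧ adj G Y k)) (∈-allFin Z)
      (Equivalence.from Bool.T-≡ (cong₂ _∧_ X∼Z Y∼Z))

  embeddings-agree-at-common-neighbour : ∀ {h adjH} {f g : Fin h → Fin n} →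
    IsEmbedding adjH (adj G) f → IsEmbedding adjH (adj G) g → ∀ {x y v} →
    x ≢ y → adjH x y ≡ false → adjH x v ≡ true → adjH y v ≡ true →
    f x ≡ g x → f y ≡ g y → f v ≡ g v
  embeddings-agree-at-common-neighbour {g = g} (f-inj , f-adj) (_ , g-adj) {x} {y} {v}
    x≢y x≁y x∼v y∼v fx≡gx fy≡gy =
    common-neighbour-unique (x≢y ∘ f-inj) (trans (f-adj x y) x≁y)
      (trans (f-adj x v) x∼v) (trans (f-adj y v) y∼v)
      (subst (λ Z → adj G Z (g v) ≡ true) (sym fx≡gx) (trans (g-adj x v) x∼v))
      (subst (λ Z → adj G Z (g v) ≡ true) (sym fy≡gy) (trans (g-adj y v) y∼v))

  -- In the Kneser model the frame is u = 0 = {0,1}, its neighbours 7, 8, 9 =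
  -- {2,3}, {2,4}, {3,4}, and 3 = {0,4} adjacent to 7; the remaining vertices
  -- 5, 4, 1, 2, 6 are successive common neighbours of non-adjacent pairs.
  petersen-rigid : ∀ {f g : Fin 10 → Fin n} →
    IsEmbedding petersenAdj (adj G) f → IsEmbedding petersenAdj (adj G) g →
    f 0F ≡ g 0F → f 7F ≡ g 7F → f 8F ≡ g 8F → f 9F ≡ g 9F → f 3F ≡ g 3F → f ≗ g
  petersen-rigid {f} {g} ef eg f0 f7 f8 f9 f3 = agree
    where
    f5 : f 5F ≡ g 5F
    f5 = embeddings-agree-at-common-neighbour ef eg (λ ()) refl refl refl f3 f8
    f4 : f 4F ≡ g 4F
    f4 = embeddings-agree-at-common-neighbour ef eg (λ ()) refl refl refl f3 f9
    f1 : f 1F ≡ g 1F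
    f1 = embeddings-agree-at-common-neighbour ef eg (λ ()) refl refl refl f5 f9
    f2 : f 2F ≡ g 2F
    f2 = embeddings-agree-at-common-neighbour ef eg (λ ()) refl refl refl f4 f8
    f6 : f 6F ≡ g 6F
    f6 = embeddings-agree-at-common-neighbour ef eg (λ ()) refl refl refl f1 f7
    agree : f ≗ g
    agree 0F = f0
    agree 1F = f1
    agree 2F = f2
    agree 3F = f3
    agree 4F = f4
    agree 5F = f5
    agree 6F = f6
    agree 7F = f7
    agree 8F = f8
    agree 9F = f9

permutations : ∀ {A : Set} {n} → Vec A n → List (Vec A n)
permutations []       = [ [] ]
permutations (x ∷ xs) = concatMap (λ p → map (λ i → insertAt p i x) (allFin _)) (permutations xs)

sameEdge : Fin 5 × Fin 5 → Fin 5 × Fin 5 → Bool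
sameEdge (a , b) (c , d) = ⌊ (a ≟ c) ×-dec (b ≟ d) ⌋ ∨ ⌊ (a ≟ d) ×-dec (b ≟ c) ⌋

-- The default 0F is never returned for a pair of distinct points; the checks
-- below are what certify the resulting maps.
edgeIndex : Fin 5 × Fin 5 → Fin 10
edgeIndex e = fromMaybe 0F (findIndexᵇ (sameEdge e) (toList petersenPairs))

inducedMap : Vec (Fin 5) 5 → Fin 10 → Fin 10
inducedMap π i with Vec.lookup petersenPairs i
... | a , b = edgeIndex (Vec.lookup π a , Vec.lookup π b)

petersenAutomorphisms : List (Vec (Fin 10) 10)
petersenAutomorphisms = map (tabulate ∘ inducedMap) (permutations (Vec.allFin 5))

IsAutomorphism : (Fin 10 → Fin 10) → Set
IsAutomorphism σ = IsEmbedding petersenAdj petersenAdj σ × StrictlySurjective _≡_ σ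

petersenAutomorphisms-isAutomorphism : All (IsAutomorphism ∘ Vec.lookup) petersenAutomorphisms
petersenAutomorphisms-isAutomorphism = toWitness {a? = All.all?
  (λ σ → isEmbedding? petersenAdj petersenAdj (Vec.lookup σ) ×-dec strictlySurjective? (Vec.lookup σ))
  petersenAutomorphisms} _

petersenAutomorphisms-unique : Unique petersenAutomorphisms
petersenAutomorphisms-unique = toWitness {a? = unique? (Vec.≡-dec (_≟_ {10})) petersenAutomorphisms} _

module Frames {n d} (G : Graph n) (regular : ∀ U → degree G U ≡ 3 + d) where

  neighbours : Fin n → List (Fin n)
  neighbours U = filterᵇ (adj G U) (allFin n)

  ∈-neighbours : ∀ {U X} → .(T (adj G U X)) → X ∈ neighbours U
  ∈-neighbours {U} {X} U∼X = ∈-filter⁺ (T? ∘ adj G U) (∈-allFin X) (recompute (T? (adj G U X)) U∼X)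

  neighbourIndex : ∀ U X → .(T (adj G U X)) → Fin (3 + d)
  neighbourIndex U X U∼X = cast (regular U) (index (∈-neighbours U∼X))

  neighbourIndex-injective : ∀ {U X Y} .{U∼X U∼Y} →
    neighbourIndex U X U∼X ≡ neighbourIndex U Y U∼Y → X ≡ Y
  neighbourIndex-injective {U} {U∼X = U∼X} {U∼Y} e = trans (lookup-index (∈-neighbours U∼X))
    (trans (cong (lookup (neighbours U)) (cast-injective (regular U) e))
           (sym (lookup-index (∈-neighbours U∼Y))))

  neighbourIndex-≢ : ∀ {U X Y} .{U∼X U∼Y} → .(X ≢ Y) →
    neighbourIndex U X U∼X ≢ neighbourIndex U Y U∼Y
  neighbourIndex-≢ X≢Y e = ⊥-elim-irr (X≢Y (neighbourIndex-injective e))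

  record Frame : Set where
    constructor frame
    field
      U A B C A₁ : Fin n
      .U∼A  : T (adj G U A)
      .U∼B  : T (adj G U B)
      .U∼C  : T (adj G U C)
      .A∼A₁ : T (adj G A A₁)
      .A≢B  : A ≢ B
      .A≢C  : A ≢ C
      .B≢C  : B ≢ C
      .A₁≢U : A₁ ≢ U

  -- A frame is coded by U, the position of A among the neighbours of U, then B
  -- and C among the remaining ones, and A₁ among the neighbours of A other than U.
  codeA : Frame → Fin (3 + d)
  codeA (frame U A _ _ _ U∼A _ _ _ _ _ _ _) = neighbourIndex U A U∼A

  codeB : Frame → Fin (2 + d)
  codeB (frame U A B _ _ U∼A U∼B _ _ A≢B _ _ _) = punchOut (neighbourIndex-≢ {U∼X = U∼A} {U∼B} A≢B)

  codeC : Frame → Fin (1 + d)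
  codeC (frame U A B C _ U∼A U∼B U∼C _ A≢B A≢C B≢C _) =
    punchOut {i = punchOut A≠B} λ e → ⊥-elim-irr (B≢C (neighbourIndex-injective
      (punchOut-injective A≠B (neighbourIndex-≢ {U∼X = U∼A} {U∼C} A≢C) e)))
    where
    A≠B = neighbourIndex-≢ {U∼X = U∼A} {U∼B} A≢B

  codeA₁ : Frame → Fin (2 + d)
  codeA₁ (frame U A _ _ A₁ U∼A _ _ A∼A₁ _ _ _ A₁≢U) =
    punchOut (neighbourIndex-≢ {U∼X = subst T (Graph.sym G U A) U∼A} {A∼A₁} (≢-sym A₁≢U))

  frameCode : Frame → Fin (n * ((3 + d) * ((2 + d) * ((1 + d) * (2 + d)))))
  frameCode F = combine (Frame.U F) (combine (codeA F) (combine (codeB F) (combine (codeC F) (codeA₁ F))))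

  frame-≡ : ∀ {F F′} → Frame.U F ≡ Frame.U F′ → Frame.A F ≡ Frame.A F′ →
    Frame.B F ≡ Frame.B F′ → Frame.C F ≡ Frame.C F′ → Frame.A₁ F ≡ Frame.A₁ F′ → F ≡ F′
  frame-≡ {frame _ _ _ _ _ _ _ _ _ _ _ _ _} {frame _ _ _ _ _ _ _ _ _ _ _ _ _}
    refl refl refl refl refl = refl

  codeA-injective : ∀ {F F′} → Frame.U F ≡ Frame.U F′ →
    codeA F ≡ codeA F′ → Frame.A F ≡ Frame.A F′
  codeA-injective {frame _ _ _ _ _ _ _ _ _ _ _ _ _} {frame _ _ _ _ _ _ _ _ _ _ _ _ _} refl =
    neighbourIndex-injective

  codeB-injective : ∀ {F F′} → Frame.U F ≡ Frame.U F′ → Frame.A F ≡ Frame.A F′ →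
    codeB F ≡ codeB F′ → Frame.B F ≡ Frame.B F′
  codeB-injective {frame _ _ _ _ _ U∼A U∼B _ _ A≢B _ _ _}
                  {frame _ _ _ _ _ _ U∼B′ _ _ A≢B′ _ _ _} refl refl =
    neighbourIndex-injective ∘ punchOut-injective (neighbourIndex-≢ {U∼X = U∼A} {U∼B} A≢B)
                                                  (neighbourIndex-≢ {U∼X = U∼A} {U∼B′} A≢B′)

  codeC-injective : ∀ {F F′} → Frame.U F ≡ Frame.U F′ → Frame.A F ≡ Frame.A F′ →
    Frame.B F ≡ Frame.B F′ → codeC F ≡ codeC F′ → Frame.C F ≡ Frame.C F′
  codeC-injective {frame _ _ _ _ _ U∼A U∼B U∼C _ A≢B A≢C B≢C _}
                  {frame _ _ _ _ _ _ _ U∼C′ _ _ A≢C′ B≢C′ _} refl refl refl =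
    neighbourIndex-injective ∘ punchOut-injective A≠C A≠C′ ∘ punchOut-injective
      (λ e → ⊥-elim-irr (B≢C (neighbourIndex-injective (punchOut-injective A≠B A≠C e))))
      (λ e → ⊥-elim-irr (B≢C′ (neighbourIndex-injective (punchOut-injective A≠B A≠C′ e))))
    where
    A≠B = neighbourIndex-≢ {U∼X = U∼A} {U∼B} A≢B
    A≠C = neighbourIndex-≢ {U∼X = U∼A} {U∼C} A≢C
    A≠C′ = neighbourIndex-≢ {U∼X = U∼A} {U∼C′} A≢C′

  codeA₁-injective : ∀ {F F′} → Frame.U F ≡ Frame.U F′ → Frame.A F ≡ Frame.A F′ →
    codeA₁ F ≡ codeA₁ F′ → Frame.A₁ F ≡ Frame.A₁ F′
  codeA₁-injective {frame U A _ _ _ U∼A _ _ A∼A₁ _ _ _ A₁≢U}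
                   {frame _ _ _ _ _ _ _ _ A∼A₁′ _ _ _ A₁≢U′} refl refl =
    neighbourIndex-injective ∘ punchOut-injective
      (neighbourIndex-≢ {U∼X = subst T (Graph.sym G U A) U∼A} {A∼A₁} (≢-sym A₁≢U))
      (neighbourIndex-≢ {U∼X = subst T (Graph.sym G U A) U∼A} {A∼A₁′} (≢-sym A₁≢U′))

  frameCode-injective : Injective _≡_ _≡_ frameCode
  frameCode-injective {F} {F′} e = frame-≡ eU eA eB eC eA₁
    where
    e₀ = combine-injective (Frame.U F) _ (Frame.U F′) _ e
    eU = proj₁ e₀
    e₁ = combine-injective (codeA F) _ (codeA F′) _ (proj₂ e₀)
    eA = codeA-injective {F} {F′} eU (proj₁ e₁)
    e₂ = combine-injective (codeB F) _ (codeB F′) _ (proj₂ e₁)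
    eB = codeB-injective {F} {F′} eU eA (proj₁ e₂)
    e₃ = combine-injective (codeC F) (codeA₁ F) (codeC F′) (codeA₁ F′) (proj₂ e₂)
    eC = codeC-injective {F} {F′} eU eA eB (proj₁ e₃)
    eA₁ = codeA₁-injective {F} {F′} eU eA (proj₂ e₃)

  frameOf : ∀ {f} → IsEmbedding petersenAdj (adj G) f → Frame
  frameOf {f} (f-inj , f-adj) =
    frame (f 0F) (f 7F) (f 8F) (f 9F) (f 3F)
      (adjacent refl) (adjacent refl) (adjacent refl) (adjacent refl)
      (distinct λ ()) (distinct λ ()) (distinct λ ()) (distinct λ ())
    where
    adjacent : ∀ {i j} → petersenAdj i j ≡ true → T (adj G (f i) (f j))
    adjacent {i} {j} i∼j = Equivalence.from Bool.T-≡ (trans (f-adj i j) i∼j)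
    distinct : ∀ {i j} → i ≢ j → f i ≢ f j
    distinct i≢j = i≢j ∘ f-inj

module _ {n d} (G : Graph n) (regular : ∀ U → degree G U ≡ 3 + d)
  (μ≤1 : ∀ X Y → X ≢ Y → adj G X Y ≡ false → commonNeighbours G X Y ≤ 1) where

  open Frames G regular
  open CommonNeighbours G μ≤1

  frameOf-injective : ∀ {f g} (ef : IsEmbedding petersenAdj (adj G) f)
    (eg : IsEmbedding petersenAdj (adj G) g) → frameOf ef ≡ frameOf eg → f ≗ g
  frameOf-injective ef eg e =
    petersen-rigid ef eg (cong Frame.U e) (cong Frame.A e) (cong Frame.B e) (cong Frame.C e)
      (cong Frame.A₁ e)

  petersen-copies-bound : (L : List (Subset n)) → Unique L → All (InducesPetersen G) L →
    length L * 120 ≤ n * ((3 + d) * ((2 + d) * ((1 + d) * (2 + d))))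
  petersen-copies-bound L L-unique L-petersen = injective₂⇒*≤ code code-injective
    where
    φ : Fin (length L) → Fin 10 → Fin n
    φ i = proj₁ (All.lookup L-petersen (∈-lookup i))

    φ-embedding : ∀ i → IsEmbedding petersenAdj (adj G) (φ i)
    φ-embedding i = InducesPetersen⇒isEmbedding {G = G} (All.lookup L-petersen (∈-lookup i))

    φ-image : ∀ i → IsImageOf (lookup L i) (φ i)
    φ-image i = proj₁ (proj₂ (proj₂ (All.lookup L-petersen (∈-lookup i))))

    σ : Fin 120 → Fin 10 → Fin 10
    σ j = Vec.lookup (lookup petersenAutomorphisms j)

    σ-automorphism : ∀ j → IsAutomorphism (σ j)
    σ-automorphism j =
      All.lookup petersenAutomorphisms-isAutomorphism (∈-lookup {xs = petersenAutomorphisms} j)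

    twisted : ∀ i j → IsEmbedding petersenAdj (adj G) (φ i ∘ σ j)
    twisted i j = isEmbedding-∘ {adjG = adj G} (φ-embedding i) (proj₁ (σ-automorphism j))

    code : Fin (length L) → Fin 120 → Fin (n * ((3 + d) * ((2 + d) * ((1 + d) * (2 + d)))))
    code i j = frameCode (frameOf (twisted i j))

    same-copy : ∀ {i j i′ j′} → φ i ∘ σ j ≗ φ i′ ∘ σ j′ → i ≡ i′
    same-copy {i} {j} {i′} {j′} agree = Unique⇒lookup-injective L-unique (⊆-antisym
      (image-⊆ (φ-image i) (φ-image i′) (proj₂ (σ-automorphism j)) agree)
      (image-⊆ (φ-image i′) (φ-image i) (proj₂ (σ-automorphism j′)) (sym ∘ agree)))

    same-automorphism : ∀ {i j j′} → φ i ∘ σ j ≗ φ i ∘ σ j′ → j ≡ j′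
    same-automorphism {i} agree = Unique⇒lookup-injective petersenAutomorphisms-unique
      (Pointwise-≡⇒≡ (ext (proj₁ (φ-embedding i) ∘ agree)))

    same-copy-and-automorphism : ∀ {i j i′ j′} → φ i ∘ σ j ≗ φ i′ ∘ σ j′ → i ≡ i′ × j ≡ j′
    same-copy-and-automorphism {i} {j} {i′} {j′} agree = i≡i′ , same-automorphism {i} {j} {j′} λ k →
      trans (agree k) (cong (λ i → φ i (σ j′ k)) (sym i≡i′))
      where i≡i′ = same-copy {i} {j} {i′} {j′} agree

    code-injective : ∀ {i j i′ j′} → code i j ≡ code i′ j′ → i ≡ i′ × j ≡ j′
    code-injective {i} {j} {i′} {j′} e = same-copy-and-automorphism {i} {j} {i′} {j′}
      (frameOf-injective (twisted i j) (twisted i′ j′)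
        (frameCode-injective {frameOf (twisted i j)} {frameOf (twisted i′ j′)} e))

mainTheorem9 : (G : Graph 3250) → IsSRG 3250 57 0 1 G →
    (L : List (Subset 3250)) → Unique L → All (InducesPetersen G) L →
    length L ≤ 266266000
mainTheorem9 G (regular , _ , μ≡1) L L-unique L-petersen =
  *-cancelʳ-≤ (length L) 266266000 120 (petersen-copies-bound G regular μ≤1 L L-unique L-petersen)
  where
  μ≤1 : ∀ X Y → X ≢ Y → adj G X Y ≡ false → commonNeighbours G X Y ≤ 1
  μ≤1 X Y X≢Y X≁Y = ≤-reflexive (μ≡1 X Y X≢Y X≁Y)
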